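{- Fix an integer $n\ge 1$. Let $S_1,S_2$ be finite nonempty disjoint subsets of $\{(a,b)\in\mathbb{Z}^2: 0\le b\le a,\ \gcd(a,b)=1\}$, and let $C'=\max\{|a_2b_1-a_1b_2|: (a_1,b_1)\in S_1,\ (a_2,b_2)\in S_2\}$. For $i=1,2$ let $T_i(n)=\{an+b: (a,b)\in S_i\}$. If a prime $p$ satisfies $p\mathbb{Z}\cap T_1(n)\ne\emptyset$ and $p\mathbb{Z}\cap T_2(n)\ne\emptyset$, then $p\le C'$. -}

module Defs where

open import Data.Nat using (ℕ; _+_; _*_; _⊔_; ∣_-_∣)
open import Data.Nat.GCD using (gcd)
open import Data.Product using (_×_; _,_)
open import Data.List using (List; foldr; map; concatMap)
open import Relation.Binary.PropositionalEquality using (_≡_)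

-- The index set {(a,b) ∈ ℤ² : 0 ≤ b ≤ a, gcd(a,b) = 1}; since 0 ≤ b ≤ a,
-- both coordinates are naturals.
Admissible : ℕ × ℕ → Set
Admissible (a , b) = (b Data.Nat.≤ a) × (gcd a b ≡ 1)

cross : ℕ × ℕ → ℕ × ℕ → ℕ
cross (a₁ , b₁) (a₂ , b₂) = ∣ a₂ * b₁ - a₁ * b₂ ∣

-- maximum of a list of naturals (0 for the empty list; all values are ≥ 0,
-- so on nonempty lists this is the usual maximum)
maxℕ : List ℕ → ℕ
maxℕ = foldr _⊔_ 0

C′ : List (ℕ × ℕ) → List (ℕ × ℕ) → ℕ
C′ S₁ S₂ = maxℕ (concatMap (λ x → map (cross x) S₂) S₁)

ev : ℕ → ℕ × ℕ → ℕ
ev n (a , b) = a * n + b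

-- Eliminating n: a₂ (a₁ n + b₁) − a₁ (a₂ n + b₂) = a₂ b₁ − a₁ b₂, so every
-- common divisor of a₁ n + b₁ and a₂ n + b₂ divides the cross term
-- |a₂ b₁ − a₁ b₂|.  That term is nonzero, since two pairs with coprime
-- coordinates that are proportional are equal, and S₁, S₂ are disjoint.
module Submission where

open import Defs
open import Data.Nat using (ℕ; _≤_; _+_; _*_; _∸_; ∣_-_∣; ≢-nonZero)
open import Data.Nat.Properties
open import Data.Nat.Divisibility using (_∣_; divides; ∣m+n∣m⇒∣n; ∣n⇒∣m*n; ∣⇒≤; ∣-antisym)
open import Data.Nat.Coprimality using (Coprime; gcd≡1⇒coprime; coprime-divisor)
  renaming (sym to coprime-sym)
open import Data.Nat.Primality using (Prime)
open import Data.Nat.Tactic.RingSolver using (solve-∀)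
open import Data.Product using (_×_; ∃-syntax; _,_)
open import Data.Sum using (inj₁; inj₂)
open import Data.List using (List; []; _∷_; map)
open import Data.List.Relation.Unary.All using (All; lookup)
open import Data.List.Relation.Unary.Any using (here; there)
import Data.List.Relation.Unary.Any as Any
open import Data.List.Membership.Propositional using (_∈_; _∉_)
open import Data.List.Membership.Propositional.Properties using (∈-map⁺; ∈-concatMap⁺)
open import Relation.Nullary using (¬_)
open import Relation.Binary.PropositionalEquality
  using (_≡_; _≢_; refl; sym; cong₂; subst; trans; module ≡-Reasoning)

∈⇒≤maxℕ : ∀ {m} xs → m ∈ xs → m ≤ maxℕ xs
∈⇒≤maxℕ (x ∷ xs) (here refl)  = m≤m⊔n x (maxℕ xs)
∈⇒≤maxℕ (x ∷ xs) (there m∈xs) = m≤n⇒m≤o⊔n x (∈⇒≤maxℕ xs m∈xs)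

cross≤C′ : ∀ {S₁ S₂ x y} → x ∈ S₁ → y ∈ S₂ → cross x y ≤ C′ S₁ S₂
cross≤C′ {S₁} {S₂} {x} x∈S₁ y∈S₂ =
  ∈⇒≤maxℕ _ (∈-concatMap⁺ (λ z → map (cross z) S₂)
                          (Any.map (λ { refl → ∈-map⁺ (cross x) y∈S₂ }) x∈S₁))

∣m∣n⇒∣n∸m : ∀ {d m n} → m ≤ n → d ∣ m → d ∣ n → d ∣ n ∸ m
∣m∣n⇒∣n∸m m≤n d∣m d∣n = ∣m+n∣m⇒∣n (subst (_ ∣_) (sym (m+[n∸m]≡n m≤n)) d∣n) d∣m

∣m∣n⇒∣∣m-n∣ : ∀ {d m n} → d ∣ m → d ∣ n → d ∣ ∣ m - n ∣
∣m∣n⇒∣∣m-n∣ {d} {m} {n} d∣m d∣n with ≤-total n m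
... | inj₁ n≤m = subst (d ∣_) (sym (m≤n⇒∣n-m∣≡n∸m n≤m)) (∣m∣n⇒∣n∸m n≤m d∣n d∣m)
... | inj₂ m≤n = subst (d ∣_) (trans (sym (m≤n⇒∣n-m∣≡n∸m m≤n)) (∣-∣-comm n m))
                       (∣m∣n⇒∣n∸m m≤n d∣m d∣n)

distrib-left-comm : ∀ a b c d → a * (b * c + d) ≡ b * (a * c) + a * d
distrib-left-comm = solve-∀

∣ev∣ev⇒∣cross : ∀ {d} n x y → d ∣ ev n x → d ∣ ev n y → d ∣ cross x y
∣ev∣ev⇒∣cross {d} n (a₁ , b₁) (a₂ , b₂) d∣x d∣y =
  subst (d ∣_) eliminate-n (∣m∣n⇒∣∣m-n∣ (∣n⇒∣m*n a₂ d∣x) (∣n⇒∣m*n a₁ d∣y))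
  where
  open ≡-Reasoning
  eliminate-n : ∣ a₂ * (a₁ * n + b₁) - a₁ * (a₂ * n + b₂) ∣ ≡ ∣ a₂ * b₁ - a₁ * b₂ ∣
  eliminate-n = begin
    ∣ a₂ * (a₁ * n + b₁) - a₁ * (a₂ * n + b₂) ∣
      ≡⟨ cong₂ ∣_-_∣ (distrib-left-comm a₂ a₁ n b₁) (*-distribˡ-+ a₁ (a₂ * n) b₂) ⟩
    ∣ a₁ * (a₂ * n) + a₂ * b₁ - a₁ * (a₂ * n) + a₁ * b₂ ∣
      ≡⟨ ∣m+n-m+o∣≡∣n-o∣ (a₁ * (a₂ * n)) (a₂ * b₁) (a₁ * b₂) ⟩
    ∣ a₂ * b₁ - a₁ * b₂ ∣ ∎

coprime-proportional⇒≡ : ∀ {a₁ b₁ a₂ b₂} → Coprime a₁ b₁ → Coprime a₂ b₂ →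
                         a₂ * b₁ ≡ a₁ * b₂ → (a₁ , b₁) ≡ (a₂ , b₂)
coprime-proportional⇒≡ {a₁} {b₁} {a₂} {b₂} c₁ c₂ a₂b₁≡a₁b₂ = cong₂ _,_
  (∣-antisym (coprime-divisor c₁ (divides b₂ b₁a₂≡b₂a₁))
             (coprime-divisor c₂ (divides b₁ (sym b₁a₂≡b₂a₁))))
  (∣-antisym (coprime-divisor (coprime-sym c₁) (divides a₂ (sym a₂b₁≡a₁b₂)))
             (coprime-divisor (coprime-sym c₂) (divides a₁ a₂b₁≡a₁b₂)))
  where
  open ≡-Reasoning
  b₁a₂≡b₂a₁ : b₁ * a₂ ≡ b₂ * a₁
  b₁a₂≡b₂a₁ = begin
    b₁ * a₂ ≡⟨ *-comm b₁ a₂ ⟩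
    a₂ * b₁ ≡⟨ a₂b₁≡a₁b₂ ⟩
    a₁ * b₂ ≡⟨ *-comm a₁ b₂ ⟩
    b₂ * a₁ ∎

distinct⇒cross≢0 : ∀ {x y} → Admissible x → Admissible y → x ≢ y → cross x y ≢ 0
distinct⇒cross≢0 (_ , gcd₁≡1) (_ , gcd₂≡1) x≢y cross≡0 =
  x≢y (coprime-proportional⇒≡ (gcd≡1⇒coprime gcd₁≡1) (gcd≡1⇒coprime gcd₂≡1) (∣m-n∣≡0⇒m≡n cross≡0))

lemma7p2 : (n : ℕ) → 1 ≤ n →
           (S₁ S₂ : List (ℕ × ℕ)) →
           ¬ (S₁ ≡ []) → ¬ (S₂ ≡ []) →
           All Admissible S₁ → All Admissible S₂ →
           (∀ x → x ∈ S₁ → x ∉ S₂) →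
           (p : ℕ) → Prime p →
           (∃[ x ] (x ∈ S₁ × p ∣ ev n x)) →
           (∃[ y ] (y ∈ S₂ × p ∣ ev n y)) →
           p ≤ C′ S₁ S₂
lemma7p2 n _ S₁ S₂ _ _ adm₁ adm₂ disjoint p _ (x , x∈S₁ , p∣x) (y , y∈S₂ , p∣y) = begin
  p         ≤⟨ ∣⇒≤ {{≢-nonZero cross≢0}} (∣ev∣ev⇒∣cross n x y p∣x p∣y) ⟩
  cross x y ≤⟨ cross≤C′ x∈S₁ y∈S₂ ⟩
  C′ S₁ S₂  ∎
  where
  open ≤-Reasoning
  cross≢0 : cross x y ≢ 0
  cross≢0 = distinct⇒cross≢0 (lookup adm₁ x∈S₁) (lookup adm₂ y∈S₂) (λ { refl → disjoint x x∈S₁ y∈S₂ })
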